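{- For all sufficiently large $d$ the following holds. Let $a', g'$ be positive integers, and suppose either $g'=d$ (the isolated case, corresponding to sets of size $1$), or $d< g' < d^4$ (the small case, for sets of size at least $2$). Then the number of 2-linked sets $A'\subseteq\mathcal E$ with $|[A']|=a'$ and $|N(A')|=g'$, and with $|A'|=1$ in the isolated case and $|A'|\ge 2$ in the small case, is at most $2^{g'}$.
   Context: $Q_d$ is the $d$-dimensional Hamming cube (vertices: binary strings of length $d$, adjacent iff they differ in exactly one coordinate), $N=2^d$. $\mathcal E$ is the set of vertices with an even number of 1's. $N(A)$ is the set of vertices adjacent to some vertex of $A$; the closure is $[A]=\{v: N(v)\subseteq N(A)\}$. A set $A$ is 2-linked if any two of its vertices are joined by a sequence of vertices of $A$ with consecutive ones at distance at most $2$ in $Q_d$. (Note $|A'|=1$ iff $|N(A')|=d$ for nonempty $A'\subseteq\mathcal E$.) -}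

module Defs where

open import Data.Bool using (Bool; true; false; _∧_; _∨_; not; if_then_else_)
open import Data.Nat using (ℕ; zero; suc; _+_; _≤_; _<_; _^_; _%_; _≤ᵇ_; _≡ᵇ_)
open import Data.Vec using (Vec; []; _∷_)
open import Data.List using (List; []; _∷_; map; _++_; filter; length)
open import Data.Bool.ListAction using (any; all)
open import Data.Product using (Σ; _×_; _,_; proj₁)
open import Data.Fin using (Fin)
open import Relation.Binary.PropositionalEquality using (_≡_)
open import Relation.Nullary.Decidable using (does)
open import Data.Bool.Properties using () renaming (_≟_ to _≟ᵇ_)

Vertex : ℕ → Set
Vertex d = Vec Bool d

allVertices : (d : ℕ) → List (Vertex d)
allVertices zero = [] ∷ []
allVertices (suc d) = map (false ∷_) (allVertices d) ++ map (true ∷_) (allVertices d)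

dist : ∀ {d} → Vertex d → Vertex d → ℕ
dist [] [] = 0
dist (x ∷ u) (y ∷ v) = (if does (x ≟ᵇ y) then 0 else 1) + dist u v

adj : ∀ {d} → Vertex d → Vertex d → Bool
adj u v = dist u v ≡ᵇ 1

weight : ∀ {d} → Vertex d → ℕ
weight [] = 0
weight (true ∷ v) = suc (weight v)
weight (false ∷ v) = weight v

-- v ∈ 𝓔 : v has an even number of 1's.
IsEven : ∀ {d} → Vertex d → Set
IsEven v = weight v % 2 ≡ 0

VSet : ℕ → Set
VSet d = Vertex d → Bool

_∈_ : ∀ {d} → Vertex d → VSet d → Set
v ∈ A = A v ≡ true

∣_∣ : ∀ {d} → VSet d → ℕ
∣_∣ {d} A = length (filter (λ v → A v ≟ᵇ true) (allVertices d))

⊆Even : ∀ {d} → VSet d → Set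
⊆Even A = ∀ v → v ∈ A → IsEven v

Nbhd : ∀ {d} → VSet d → VSet d
Nbhd {d} A v = any (λ u → A u ∧ adj u v) (allVertices d)

closure : ∀ {d} → VSet d → VSet d
closure {d} A v = all (λ w → not (adj v w) ∨ Nbhd A w) (allVertices d)

data Walk2 {d : ℕ} (A : VSet d) : Vertex d → Vertex d → Set where
  here : ∀ {u} → Walk2 A u u
  step : ∀ {u w v} → w ∈ A → dist u w ≤ 2 → Walk2 A w v → Walk2 A u v

TwoLinked : ∀ {d} → VSet d → Set
TwoLinked A = ∀ u v → u ∈ A → v ∈ A → Walk2 A u v

Counted : (d a g : ℕ) → Set
Counted d a g = Σ (VSet d) λ A →
  ⊆Even A × TwoLinked A × ∣ closure A ∣ ≡ a × ∣ Nbhd A ∣ ≡ g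
  × (g ≡ d → ∣ A ∣ ≡ 1) × (d < g → 2 ≤ ∣ A ∣)

-- "The number of elements of Counted d a g is at most K":
-- an injection (modulo extensional equality of sets) into Fin K.
AtMost : (d a g K : ℕ) → Set
AtMost d a g K = Σ (Counted d a g → Fin K) λ f →
  ∀ x y → f x ≡ f y → ∀ v → proj₁ x v ≡ proj₁ y v

-- Encode a 2-linked set A with |N(A)| = g by a tour: a walk in A with steps of Hamming length
-- at most 2 that starts at some u ∈ A and visits all of A. Inserting a detour t → x → t for
-- each newly reached vertex x gives such a tour with 2(|A| − 1) steps, each a pair of coordinate
-- flips, so A is determined by one of at most 2^d (d + 1)^(4(|A| − 1)) codes, and it remains to
-- show d + 4 log₂(d + 1) (|A| − 1) ≤ g. For |A| = 1 this is g = d. For |A| ≥ 2, two vertices of A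
-- have at most two common neighbours, so g ≥ 2d − 2; and S = A ∪ N(A) has at most 2g ≤ 2d⁴
-- vertices and at least |A| d / 2 edges, so the edge-isoperimetric inequality e(S) ≤ |S| log₂|S|
-- gives |A| d = O((|A| + g) log d). For d ≥ 2^14 these two bounds give the claim.

module Submission where

open import Defs
open import Data.Bool using (Bool; true; false; _∧_; _∨_; not)
open import Data.Bool.Properties using (T-≡; ∧-comm; ∧-conicalˡ; ∧-conicalʳ; ∨-zeroʳ) renaming (_≟_ to _≟ᵇ_)
open import Data.Empty using (⊥-elim)
open import Data.Fin using (Fin; zero; suc; combine; inject≤)
open import Data.Fin.Properties using (combine-injective; inject≤-injective; *↔×; 2↔Bool)
open import Data.List using (List; []; _∷_; map; _++_; filter; length)
import Data.List.Membership.DecPropositional as DecMembership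
open import Data.List.Membership.Propositional using (lose) renaming (_∈_ to _∈ₗ_)
open import Data.List.Membership.Propositional.Properties using (∈-++⁺ˡ; ∈-++⁺ʳ; ∈-map⁺)
import Data.List.Properties as List
open import Data.List.Relation.Unary.All using (All; []; _∷_; head; lookup)
open import Data.List.Relation.Unary.Any using (here; there)
open import Data.List.Relation.Unary.Any.Properties using (any⁺)
open import Data.List.Relation.Unary.Linked using (Linked; []; [-]; _∷_)
open import Data.Nat using (ℕ; zero; suc; _+_; _*_; _∸_; _≤_; _<_; _^_; _≡ᵇ_; z≤n; s≤s; s≤s⁻¹; NonZero; >-nonZero; _≤?_; _<?_)
open import Data.Nat.DivMod using (_/_; m/n*n≤m; m*n/n≡m; /-monoˡ-≤)
open import Data.Nat.ListAction using (sum)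
open import Data.Nat.ListAction.Properties using (sum-++)
open import Data.Nat.Properties
open import Algebra.Properties.CommutativeSemigroup +-commutativeSemigroup using () renaming (interchange to +-interchange)
open import Data.Nat.Tactic.RingSolver using (solve-∀)
open import Data.Product using (Σ; Σ-syntax; ∃-syntax; _×_; _,_; proj₁; proj₂)
open import Data.Product.Function.NonDependent.Propositional using (_×-↣_)
open import Data.Sum using (_⊎_; inj₁; inj₂)
open import Data.Vec using (Vec; []; _∷_; updateAt)
import Data.Vec as Vec
open import Data.Vec.Properties using (≡-dec)
open import Function using (_∘_; case_of_)
open import Function.Bundles using (Equivalence; Injection; _↣_; mk↣)
open import Function.Construct.Composition using (_↣-∘_)
open import Function.Construct.Identity using (↣-id)
open import Function.Definitions using (Injective)
open import Function.Properties.Inverse using (↔⇒↣; ↔-sym)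
open import Relation.Binary.PropositionalEquality
open import Relation.Nullary using (¬_; Dec; yes; no; does)
open import Relation.Nullary.Decidable using (dec-true; dec-false)

χ : Bool → ℕ
χ true = 1
χ false = 0

χ≤1 : ∀ b → χ b ≤ 1
χ≤1 true = ≤-refl
χ≤1 false = z≤n

χ-∧ : ∀ a b → χ (a ∧ b) ≡ χ a * χ b
χ-∧ true b = sym (+-identityʳ (χ b))
χ-∧ false b = refl

χ-mono : ∀ {a b} → (a ≡ true → b ≡ true) → χ a ≤ χ b
χ-mono {true} f rewrite f refl = ≤-refl
χ-mono {false} f = z≤n

χ*χ-mono : ∀ {a b c} → (a ≡ true → b ≡ true → c ≡ true) → χ a * χ b ≤ χ c
χ*χ-mono {true} {true} f rewrite f refl refl = ≤-refl
χ*χ-mono {true} {false} f = z≤n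
χ*χ-mono {false} f = z≤n

χ+χ≤χ+χ*χ : ∀ {a b c} → (a ≡ true → c ≡ true) → (b ≡ true → c ≡ true) →
            χ a + χ b ≤ χ c + χ a * χ b
χ+χ≤χ+χ*χ {true} {true} f g rewrite f refl = ≤-refl
χ+χ≤χ+χ*χ {true} {false} f g rewrite f refl = ≤-refl
χ+χ≤χ+χ*χ {false} {true} f g rewrite g refl = ≤-refl
χ+χ≤χ+χ*χ {false} {false} f g = z≤n

χ>0⇒≡true : ∀ {b} → 0 < χ b → b ≡ true
χ>0⇒≡true {true} _ = refl

sumV : ∀ d → (Vertex d → ℕ) → ℕ
sumV zero f = f []
sumV (suc d) f = sumV d (λ v → f (false ∷ v)) + sumV d (λ v → f (true ∷ v))

sumV-cong : ∀ d {f g : Vertex d → ℕ} → (∀ v → f v ≡ g v) → sumV d f ≡ sumV d g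
sumV-cong zero e = e []
sumV-cong (suc d) e = cong₂ _+_ (sumV-cong d (λ v → e (false ∷ v))) (sumV-cong d (λ v → e (true ∷ v)))

sumV-mono-≤ : ∀ d {f g : Vertex d → ℕ} → (∀ v → f v ≤ g v) → sumV d f ≤ sumV d g
sumV-mono-≤ zero e = e []
sumV-mono-≤ (suc d) e = +-mono-≤ (sumV-mono-≤ d (λ v → e (false ∷ v))) (sumV-mono-≤ d (λ v → e (true ∷ v)))

sumV-mono-< : ∀ d {f g : Vertex d → ℕ} → (∀ v → f v ≤ g v) → ∀ u → f u < g u → sumV d f < sumV d g
sumV-mono-< zero e [] lt = lt
sumV-mono-< (suc d) e (false ∷ u) lt =
  +-mono-<-≤ (sumV-mono-< d (λ v → e (false ∷ v)) u lt) (sumV-mono-≤ d (λ v → e (true ∷ v)))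
sumV-mono-< (suc d) e (true ∷ u) lt =
  +-mono-≤-< (sumV-mono-≤ d (λ v → e (false ∷ v))) (sumV-mono-< d (λ v → e (true ∷ v)) u lt)

sumV-zero : ∀ d → sumV d (λ _ → 0) ≡ 0
sumV-zero zero = refl
sumV-zero (suc d) = cong₂ _+_ (sumV-zero d) (sumV-zero d)

sumV-+ : ∀ d (f g : Vertex d → ℕ) → sumV d (λ v → f v + g v) ≡ sumV d f + sumV d g
sumV-+ zero f g = refl
sumV-+ (suc d) f g =
  trans (cong₂ _+_ (sumV-+ d _ _) (sumV-+ d _ _)) (+-interchange (side f false) (side g false) (side f true) (side g true))
  where
  side : (Vertex (suc d) → ℕ) → Bool → ℕ
  side h b = sumV d (λ v → h (b ∷ v))

sumV-*ˡ : ∀ d c (f : Vertex d → ℕ) → sumV d (λ v → c * f v) ≡ c * sumV d f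
sumV-*ˡ zero c f = refl
sumV-*ˡ (suc d) c f =
  trans (cong₂ _+_ (sumV-*ˡ d c _) (sumV-*ˡ d c _)) (sym (*-distribˡ-+ c (sumV d (λ v → f (false ∷ v))) _))

sumV-*ʳ : ∀ d c (f : Vertex d → ℕ) → sumV d (λ v → f v * c) ≡ sumV d f * c
sumV-*ʳ d c f = trans (sumV-cong d (λ v → *-comm (f v) c)) (trans (sumV-*ˡ d c f) (*-comm c _))

sumV-swap : ∀ d e (f : Vertex d → Vertex e → ℕ) →
            sumV d (λ u → sumV e (λ v → f u v)) ≡ sumV e (λ v → sumV d (λ u → f u v))
sumV-swap zero e f = refl
sumV-swap (suc d) e f = trans (cong₂ _+_ (sumV-swap d e _) (sumV-swap d e _)) (sym (sumV-+ e _ _))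

sumV-single-≤ : ∀ d (f : Vertex d → ℕ) u → f u ≤ sumV d f
sumV-single-≤ zero f [] = ≤-refl
sumV-single-≤ (suc d) f (false ∷ u) = ≤-trans (sumV-single-≤ d _ u) (m≤m+n _ _)
sumV-single-≤ (suc d) f (true ∷ u) = ≤-trans (sumV-single-≤ d _ u) (m≤n+m _ _)

sumV>0⇒∃ : ∀ d (f : Vertex d → ℕ) → 0 < sumV d f → ∃[ v ] 0 < f v
sumV>0⇒∃ zero f p = [] , p
sumV>0⇒∃ (suc d) f p with sumV d (λ v → f (false ∷ v)) in eq
... | zero = let (v , q) = sumV>0⇒∃ d (λ v → f (true ∷ v)) p in true ∷ v , q
... | suc _ = let (v , q) = sumV>0⇒∃ d (λ v → f (false ∷ v)) (subst (0 <_) (sym eq) (s≤s z≤n)) in false ∷ v , q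

sumV≡0⇒≡0 : ∀ d (f : Vertex d → ℕ) → sumV d f ≡ 0 → ∀ v → f v ≡ 0
sumV≡0⇒≡0 d f p v = n≤0⇒n≡0 (subst (f v ≤_) p (sumV-single-≤ d f v))

count : ∀ {d} → VSet d → ℕ
count {d} A = sumV d (λ v → χ (A v))

∣∣≡count : ∀ {d} (A : VSet d) → ∣ A ∣ ≡ count A
∣∣≡count {d} A = trans (length-filter (allVertices d)) (sum-map-allVertices d _)
  where
  open ≡-Reasoning
  length-filter : (xs : List (Vertex d)) → length (filter (λ v → A v ≟ᵇ true) xs) ≡ sum (map (λ v → χ (A v)) xs)
  length-filter [] = refl
  length-filter (x ∷ xs) with A x
  ... | true = cong suc (length-filter xs)
  ... | false = length-filter xs
  sum-map-allVertices : ∀ d (h : Vertex d → ℕ) → sum (map h (allVertices d)) ≡ sumV d h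
  sum-map-allVertices zero h = +-identityʳ (h [])
  sum-map-allVertices (suc d) h = begin
      sum (map h (map (false ∷_) vs ++ map (true ∷_) vs))
    ≡⟨ cong sum (List.map-++ h (map (false ∷_) vs) _) ⟩
      sum (map h (map (false ∷_) vs) ++ map h (map (true ∷_) vs))
    ≡⟨ sum-++ (map h (map (false ∷_) vs)) _ ⟩
      sum (map h (map (false ∷_) vs)) + sum (map h (map (true ∷_) vs))
    ≡⟨ cong₂ _+_ (cong sum (sym (List.map-∘ vs))) (cong sum (sym (List.map-∘ vs))) ⟩
      sum (map (λ v → h (false ∷ v)) vs) + sum (map (λ v → h (true ∷ v)) vs)
    ≡⟨ cong₂ _+_ (sum-map-allVertices d _) (sum-map-allVertices d _) ⟩
      sumV (suc d) h ∎
    where vs = allVertices d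

count-∪-≤ : ∀ {d} (A B : VSet d) → count (λ v → A v ∨ B v) ≤ count A + count B
count-∪-≤ {d} A B = ≤-trans (sumV-mono-≤ d (λ v → χ-∨-≤ (A v) (B v))) (≤-reflexive (sumV-+ d _ _))
  where
  χ-∨-≤ : ∀ a b → χ (a ∨ b) ≤ χ a + χ b
  χ-∨-≤ true b = s≤s z≤n
  χ-∨-≤ false b = ≤-refl

count>0⇒∈ : ∀ {d} (A : VSet d) → 0 < count A → ∃[ u ] u ∈ A
count>0⇒∈ {d} A pos = let (u , χAu>0) = sumV>0⇒∃ d _ pos in u , χ>0⇒≡true χAu>0

-- Tested through dist, so that adj (b ∷ u) (not b ∷ v) reduces to eqV u v.
eqV : ∀ {d} → Vertex d → Vertex d → Bool
eqV u v = dist u v ≡ᵇ 0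

dist-refl : ∀ {d} (u : Vertex d) → dist u u ≡ 0
dist-refl [] = refl
dist-refl (false ∷ u) = dist-refl u
dist-refl (true ∷ u) = dist-refl u

dist-sym : ∀ {d} (u v : Vertex d) → dist u v ≡ dist v u
dist-sym [] [] = refl
dist-sym (false ∷ u) (false ∷ v) = dist-sym u v
dist-sym (true ∷ u) (true ∷ v) = dist-sym u v
dist-sym (false ∷ u) (true ∷ v) = cong suc (dist-sym u v)
dist-sym (true ∷ u) (false ∷ v) = cong suc (dist-sym u v)

dist≡0⇒≡ : ∀ {d} (u v : Vertex d) → dist u v ≡ 0 → u ≡ v
dist≡0⇒≡ [] [] _ = refl
dist≡0⇒≡ (false ∷ u) (false ∷ v) e = cong (false ∷_) (dist≡0⇒≡ u v e)
dist≡0⇒≡ (true ∷ u) (true ∷ v) e = cong (true ∷_) (dist≡0⇒≡ u v e)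

adj-sym : ∀ {d} (u v : Vertex d) → adj u v ≡ adj v u
adj-sym u v = cong (_≡ᵇ 1) (dist-sym u v)

eqV-refl : ∀ {d} (u : Vertex d) → eqV u u ≡ true
eqV-refl u = cong (_≡ᵇ 0) (dist-refl u)

χ-eqV-≢ : ∀ {d} {u v : Vertex d} → ¬ u ≡ v → χ (eqV u v) ≡ 0
χ-eqV-≢ {u = u} {v} u≢v with dist u v in e
... | zero = ⊥-elim (u≢v (dist≡0⇒≡ u v e))
... | suc _ = refl

sumV-δ : ∀ d u (f : Vertex d → ℕ) → sumV d (λ v → χ (eqV u v) * f v) ≡ f u
sumV-δ zero [] f = +-identityʳ (f [])
sumV-δ (suc d) (false ∷ u) f rewrite sumV-zero d = trans (+-identityʳ _) (sumV-δ d u (λ v → f (false ∷ v)))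
sumV-δ (suc d) (true ∷ u) f rewrite sumV-zero d = sumV-δ d u (λ v → f (true ∷ v))

sumV-δ-∧ : ∀ d u (P : VSet d) → sumV d (λ v → χ (eqV u v ∧ P v)) ≡ χ (P u)
sumV-δ-∧ d u P = trans (sumV-cong d (λ v → χ-∧ (eqV u v) (P v))) (sumV-δ d u _)

sumV-eqV : ∀ d (u : Vertex d) → sumV d (λ v → χ (eqV u v)) ≡ 1
sumV-eqV d u = trans (sumV-cong d (λ v → sym (*-identityʳ _))) (sumV-δ d u (λ _ → 1))

degree : ∀ d (u : Vertex d) → sumV d (λ v → χ (adj u v)) ≡ d
degree zero [] = refl
degree (suc d) (false ∷ u) = trans (cong₂ _+_ (degree d u) (sumV-eqV d u)) (+-comm d 1)
degree (suc d) (true ∷ u) = cong₂ _+_ (sumV-eqV d u) (degree d u)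

sumV-δ-≤1 : ∀ d u (b : Vertex d → Bool) → sumV d (λ v → χ (eqV u v) * χ (b v)) ≤ 1
sumV-δ-≤1 d u b = ≤-trans (≤-reflexive (sumV-δ d u _)) (χ≤1 (b u))

sumV-δ-≤1′ : ∀ d u (b : Vertex d → Bool) → sumV d (λ v → χ (b v) * χ (eqV u v)) ≤ 1
sumV-δ-≤1′ d u b = ≤-trans (≤-reflexive (sumV-cong d (λ v → *-comm (χ (b v)) _))) (sumV-δ-≤1 d u b)

sumV-δ-≢ : ∀ d (u w : Vertex d) → ¬ u ≡ w → sumV d (λ v → χ (eqV u v) * χ (eqV w v)) ≡ 0
sumV-δ-≢ d u w u≢w = trans (sumV-δ d u _) (χ-eqV-≢ (u≢w ∘ sym))

common-neighbours : ∀ d (u w : Vertex d) → ¬ u ≡ w → sumV d (λ v → χ (adj u v) * χ (adj w v)) ≤ 2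
common-neighbours zero [] [] u≢w = ⊥-elim (u≢w refl)
common-neighbours (suc d) (false ∷ a) (false ∷ b) u≢w =
  +-mono-≤ (common-neighbours d a b (u≢w ∘ cong (false ∷_)))
           (≤-reflexive (sumV-δ-≢ d a b (u≢w ∘ cong (false ∷_))))
common-neighbours (suc d) (true ∷ a) (true ∷ b) u≢w =
  +-mono-≤ (≤-reflexive (sumV-δ-≢ d a b (u≢w ∘ cong (true ∷_))))
           (common-neighbours d a b (u≢w ∘ cong (true ∷_)))
common-neighbours (suc d) (false ∷ a) (true ∷ b) _ = +-mono-≤ (sumV-δ-≤1′ d b (adj a)) (sumV-δ-≤1 d a (adj b))
common-neighbours (suc d) (true ∷ a) (false ∷ b) _ = +-mono-≤ (sumV-δ-≤1 d a (adj b)) (sumV-δ-≤1′ d b (adj a))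

sumV-sumV-adjˡ : ∀ d (f : Vertex d → ℕ) → sumV d (λ u → sumV d (λ v → f u * χ (adj u v))) ≡ sumV d f * d
sumV-sumV-adjˡ d f = trans (sumV-cong d (λ u → trans (sumV-*ˡ d (f u) _) (cong (f u *_) (degree d u)))) (sumV-*ʳ d d f)

sumV-sumV-adjʳ : ∀ d (f : Vertex d → ℕ) → sumV d (λ u → sumV d (λ v → f v * χ (adj u v))) ≡ sumV d f * d
sumV-sumV-adjʳ d f = begin
    sumV d (λ u → sumV d (λ v → f v * χ (adj u v)))
  ≡⟨ sumV-swap d d _ ⟩
    sumV d (λ v → sumV d (λ u → f v * χ (adj u v)))
  ≡⟨ sumV-cong d (λ v → sumV-cong d (λ u → cong (λ b → f v * χ b) (adj-sym u v))) ⟩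
    sumV d (λ v → sumV d (λ u → f v * χ (adj v u)))
  ≡⟨ sumV-sumV-adjˡ d f ⟩
    sumV d f * d ∎
  where open ≡-Reasoning

count≤count-without+1 : ∀ {d} (A : VSet d) u → count A ≤ count (λ v → A v ∧ not (eqV u v)) + 1
count≤count-without+1 {d} A u = ≤-trans (sumV-mono-≤ d (λ v → χ≤χ∧not+χ (A v) (eqV u v)))
                                         (≤-reflexive (trans (sumV-+ d _ _) (cong (count A∖u +_) (sumV-eqV d u))))
  where
  A∖u : VSet d
  A∖u v = A v ∧ not (eqV u v)
  χ≤χ∧not+χ : ∀ a e → χ a ≤ χ (a ∧ not e) + χ e
  χ≤χ∧not+χ true true = s≤s z≤n
  χ≤χ∧not+χ true false = ≤-refl
  χ≤χ∧not+χ false e = z≤n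

count≥2⇒distinct : ∀ {d} (A : VSet d) → 2 ≤ count A → ∃[ u ] ∃[ w ] u ∈ A × w ∈ A × ¬ u ≡ w
count≥2⇒distinct A 2≤∣A∣ with count>0⇒∈ A (≤-trans (s≤s z≤n) 2≤∣A∣)
... | u , uA with count>0⇒∈ _ (+-cancelʳ-≤ 1 1 _ (≤-trans 2≤∣A∣ (count≤count-without+1 A u)))
... | w , _ with A w in wA | eqV u w in eqV≡false
... | true | false = u , w , uA , wA , λ { refl → case trans (sym eqV≡false) (eqV-refl u) of λ () }

allVertices-complete : ∀ d (v : Vertex d) → v ∈ₗ allVertices d
allVertices-complete zero [] = here refl
allVertices-complete (suc d) (false ∷ v) = ∈-++⁺ˡ (∈-map⁺ (false ∷_) (allVertices-complete d v))
allVertices-complete (suc d) (true ∷ v) =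
  ∈-++⁺ʳ (map (false ∷_) (allVertices d)) (∈-map⁺ (true ∷_) (allVertices-complete d v))

Nbhd-intro : ∀ {d} (A : VSet d) {u v} → u ∈ A → adj u v ≡ true → v ∈ Nbhd A
Nbhd-intro {d} A {u} uA uv =
  Equivalence.to T-≡ (any⁺ _ (lose (allVertices-complete d u) (Equivalence.from T-≡ (cong₂ _∧_ uA uv))))

count≤count-Nbhd : ∀ d (A : VSet d) .{{_ : NonZero d}} → count A ≤ count (Nbhd A)
count≤count-Nbhd d A = *-cancelʳ-≤ (count A) (count (Nbhd A)) d (begin
    count A * d
  ≡⟨ sym (sumV-sumV-adjˡ d (λ u → χ (A u))) ⟩
    sumV d (λ u → sumV d (λ v → χ (A u) * χ (adj u v)))
  ≤⟨ sumV-mono-≤ d (λ u → sumV-mono-≤ d (λ v →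
       χ*χ-mono {A u} {adj u v} (λ uA uv → cong₂ _∧_ (Nbhd-intro A {u} uA uv) uv))) ⟩
    sumV d (λ u → sumV d (λ v → χ (Nbhd A v ∧ adj u v)))
  ≡⟨ sumV-cong d (λ u → sumV-cong d (λ v → χ-∧ (Nbhd A v) (adj u v))) ⟩
    sumV d (λ u → sumV d (λ v → χ (Nbhd A v) * χ (adj u v)))
  ≡⟨ sumV-sumV-adjʳ d (λ v → χ (Nbhd A v)) ⟩
    count (Nbhd A) * d ∎)
  where open ≤-Reasoning

two-vertices-Nbhd : ∀ d (A : VSet d) {u w} → u ∈ A → w ∈ A → ¬ u ≡ w → d + d ≤ count (Nbhd A) + 2
two-vertices-Nbhd d A {u} {w} uA wA u≢w = begin
    d + d
  ≡⟨ sym (cong₂ _+_ (degree d u) (degree d w)) ⟩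
    sumV d (λ v → χ (adj u v)) + sumV d (λ v → χ (adj w v))
  ≡⟨ sym (sumV-+ d _ _) ⟩
    sumV d (λ v → χ (adj u v) + χ (adj w v))
  ≤⟨ sumV-mono-≤ d (λ v → χ+χ≤χ+χ*χ {adj u v} {adj w v} (Nbhd-intro A {u} uA) (Nbhd-intro A {w} wA)) ⟩
    sumV d (λ v → χ (Nbhd A v) + χ (adj u v) * χ (adj w v))
  ≡⟨ sumV-+ d _ _ ⟩
    count (Nbhd A) + sumV d (λ v → χ (adj u v) * χ (adj w v))
  ≤⟨ +-monoʳ-≤ (count (Nbhd A)) (common-neighbours d u w u≢w) ⟩
    count (Nbhd A) + 2 ∎
  where open ≤-Reasoning

-- Edge isoperimetry

half : ∀ {d} → Bool → VSet (suc d) → VSet d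
half b S v = S (b ∷ v)

-- Twice the number of edges of Q_d inside S.
inducedDegreeSum : ∀ {d} → VSet d → ℕ
inducedDegreeSum {d} S = sumV d (λ u → sumV d (λ v → χ (adj u v ∧ (S u ∧ S v))))

inducedDegreeSum-suc : ∀ {d} (S : VSet (suc d)) →
  inducedDegreeSum S ≡ inducedDegreeSum (half false S) + inducedDegreeSum (half true S)
                       + 2 * count (λ u → half false S u ∧ half true S u)
inducedDegreeSum-suc {d} S = begin
    inducedDegreeSum S
  ≡⟨ cong₂ _+_ (sumV-+ d _ _) (sumV-+ d _ _) ⟩
    (I₀ + sumV d (λ u → sumV d (λ v → χ (eqV u v ∧ (S₀ u ∧ S₁ v)))))
      + (sumV d (λ u → sumV d (λ v → χ (eqV u v ∧ (S₁ u ∧ S₀ v)))) + I₁)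
  ≡⟨ cong₂ (λ x y → (I₀ + x) + (y + I₁))
       (sumV-cong d (λ u → sumV-δ-∧ d u (λ v → S₀ u ∧ S₁ v)))
       (sumV-cong d (λ u → trans (sumV-δ-∧ d u (λ v → S₁ u ∧ S₀ v)) (cong χ (∧-comm (S₁ u) (S₀ u))))) ⟩
    (I₀ + c) + (c + I₁)
  ≡⟨ rearrange I₀ I₁ c ⟩
    I₀ + I₁ + 2 * c ∎
  where
  open ≡-Reasoning
  S₀ = half false S
  S₁ = half true S
  I₀ = inducedDegreeSum S₀
  I₁ = inducedDegreeSum S₁
  c = count (λ u → S₀ u ∧ S₁ u)
  rearrange : ∀ x y z → (x + z) + (z + y) ≡ x + y + 2 * z
  rearrange = solve-∀

isoperimetric-step-≤ : ∀ L {a b c e₀ e₁} → a ≤ b → a + b ≤ 2 ^ L → c ≤ a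
  → (∀ L → a ≤ 2 ^ L → e₀ ≤ 2 * a * L) → (∀ L → b ≤ 2 ^ L → e₁ ≤ 2 * b * L)
  → e₀ + e₁ + 2 * c ≤ 2 * (a + b) * L
isoperimetric-step-≤ zero {zero} _ b≤1 z≤n ih₀ ih₁ =
  ≤-trans (+-monoˡ-≤ 0 (+-mono-≤ (ih₀ 0 z≤n) (ih₁ 0 b≤1))) (≤-reflexive (+-identityʳ _))
isoperimetric-step-≤ zero {suc a} (s≤s _) (s≤s a+b≤0) _ _ _ = case m+n≤o⇒n≤o a a+b≤0 of λ ()
isoperimetric-step-≤ (suc L) {a} {b} {c} {e₀} {e₁} a≤b a+b≤2^1+L c≤a ih₀ ih₁ = begin
    e₀ + e₁ + 2 * c
  ≤⟨ +-mono-≤ (+-mono-≤ (ih₀ L a≤2^L) (ih₁ (suc L) (m+n≤o⇒n≤o a a+b≤2^1+L))) (*-monoʳ-≤ 2 c≤a) ⟩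
    2 * a * L + 2 * b * suc L + 2 * a
  ≡⟨ expand a b L ⟩
    2 * (a + b) * suc L ∎
  where
  open ≤-Reasoning
  a≤2^L : a ≤ 2 ^ L
  a≤2^L = *-cancelˡ-≤ 2 (≤-trans (+-monoʳ-≤ a (≤-reflexive (+-identityʳ a)))
                                 (≤-trans (+-monoʳ-≤ a a≤b) a+b≤2^1+L))
  expand : ∀ a b L → 2 * a * L + 2 * b * suc L + 2 * a ≡ 2 * (a + b) * suc L
  expand = solve-∀

isoperimetric-step : ∀ L {a b c e₀ e₁} → a + b ≤ 2 ^ L → c ≤ a → c ≤ b
  → (∀ L → a ≤ 2 ^ L → e₀ ≤ 2 * a * L) → (∀ L → b ≤ 2 ^ L → e₁ ≤ 2 * b * L)
  → e₀ + e₁ + 2 * c ≤ 2 * (a + b) * L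
isoperimetric-step L {a} {b} {c} {e₀} {e₁} a+b≤2^L c≤a c≤b ih₀ ih₁ with ≤-total a b
... | inj₁ a≤b = isoperimetric-step-≤ L a≤b a+b≤2^L c≤a ih₀ ih₁
... | inj₂ b≤a = subst₂ _≤_ (cong (_+ 2 * c) (+-comm e₁ e₀)) (cong (λ x → 2 * x * L) (+-comm b a))
                   (isoperimetric-step-≤ L b≤a (subst (_≤ 2 ^ L) (+-comm a b) a+b≤2^L) c≤b ih₁ ih₀)

-- Twice the sharp bound e(S) ≤ |S| log₂|S| / 2, which is what the split into two subcubes gives
-- without any convexity argument; only the order log |S| matters below.
inducedDegreeSum-≤ : ∀ d (S : VSet d) L → count S ≤ 2 ^ L → inducedDegreeSum S ≤ 2 * count S * L
inducedDegreeSum-≤ zero S L _ = z≤n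
inducedDegreeSum-≤ (suc d) S L ∣S∣≤2^L =
  ≤-trans (≤-reflexive (inducedDegreeSum-suc S))
    (isoperimetric-step L ∣S∣≤2^L
      (sumV-mono-≤ d (λ u → χ-mono (∧-conicalˡ (S (false ∷ u)) _)))
      (sumV-mono-≤ d (λ u → χ-mono (∧-conicalʳ _ (S (true ∷ u)))))
      (inducedDegreeSum-≤ d (half false S)) (inducedDegreeSum-≤ d (half true S)))

count*d≤inducedDegreeSum : ∀ d (A : VSet d) → count A * d ≤ inducedDegreeSum (λ v → A v ∨ Nbhd A v)
count*d≤inducedDegreeSum d A = begin
    count A * d
  ≡⟨ sym (sumV-sumV-adjˡ d (λ u → χ (A u))) ⟩
    sumV d (λ u → sumV d (λ v → χ (A u) * χ (adj u v)))
  ≤⟨ sumV-mono-≤ d (λ u → sumV-mono-≤ d (λ v → χ*χ-mono {A u} {adj u v} (both-in-closed-nbhd u v))) ⟩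
    inducedDegreeSum (λ v → A v ∨ Nbhd A v) ∎
  where
  open ≤-Reasoning
  both-in-closed-nbhd : ∀ u v → u ∈ A → adj u v ≡ true →
                        adj u v ∧ ((A u ∨ Nbhd A u) ∧ (A v ∨ Nbhd A v)) ≡ true
  both-in-closed-nbhd u v uA uv =
    cong₂ _∧_ uv (cong₂ _∧_ (cong (_∨ Nbhd A u) uA) (trans (cong (A v ∨_) (Nbhd-intro A uA uv)) (∨-zeroʳ (A v))))

-- Tours through 2-linked sets

module _ {X : Set} where

  -- The tail of x₀ ∷ xs with the excursion t → x → t inserted at the occurrence t∈ of t.
  detour : (x₀ : X) (xs : List X) {t : X} → t ∈ₗ x₀ ∷ xs → X → List X
  detour x₀ xs (here refl) x = x ∷ x₀ ∷ xs
  detour x₀ (y ∷ xs) (there t∈) x = y ∷ detour y xs t∈ x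

  length-detour : ∀ x₀ xs {t} (t∈ : t ∈ₗ x₀ ∷ xs) x → length (detour x₀ xs t∈ x) ≡ 2 + length xs
  length-detour x₀ xs (here refl) x = refl
  length-detour x₀ (y ∷ xs) (there t∈) x = cong suc (length-detour y xs t∈ x)

  ∈-detour⁺ : ∀ x₀ xs {t} (t∈ : t ∈ₗ x₀ ∷ xs) x {y} →
              y ∈ₗ x₀ ∷ xs → y ∈ₗ x₀ ∷ detour x₀ xs t∈ x
  ∈-detour⁺ x₀ xs t∈ x (here y≡x₀) = here y≡x₀
  ∈-detour⁺ x₀ xs (here refl) x (there y∈) = there (there (there y∈))
  ∈-detour⁺ x₀ (z ∷ xs) (there t∈) x (there y∈) = there (∈-detour⁺ z xs t∈ x y∈)

  ∈-detour : ∀ x₀ xs {t} (t∈ : t ∈ₗ x₀ ∷ xs) x → x ∈ₗ x₀ ∷ detour x₀ xs t∈ x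
  ∈-detour x₀ xs (here refl) x = there (here refl)
  ∈-detour x₀ (y ∷ xs) (there t∈) x = there (∈-detour y xs t∈ x)

  All-detour : ∀ {P : X → Set} x₀ xs {t} (t∈ : t ∈ₗ x₀ ∷ xs) {x} →
               All P (x₀ ∷ xs) → P x → All P (x₀ ∷ detour x₀ xs t∈ x)
  All-detour x₀ xs (here refl) (p₀ ∷ ps) px = p₀ ∷ px ∷ p₀ ∷ ps
  All-detour x₀ (y ∷ xs) (there t∈) (p₀ ∷ ps) px = p₀ ∷ All-detour y xs t∈ ps px

  Linked-detour : ∀ {R : X → X → Set} x₀ xs {t} (t∈ : t ∈ₗ x₀ ∷ xs) {x} →
                  Linked R (x₀ ∷ xs) → R t x → R x t → Linked R (x₀ ∷ detour x₀ xs t∈ x)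
  Linked-detour x₀ xs (here refl) l r r′ = r ∷ r′ ∷ l
  Linked-detour x₀ (y ∷ xs) (there t∈) (r₀ ∷ l) r r′ = r₀ ∷ Linked-detour y xs t∈ l r r′

Near : ∀ {d} → Vertex d → Vertex d → Set
Near u v = dist u v ≤ 2

Near-sym : ∀ {d} (u v : Vertex d) → Near u v → Near v u
Near-sym u v = subst (_≤ 2) (dist-sym u v)

Near-refl : ∀ {d} (u : Vertex d) → Near u u
Near-refl u = subst (_≤ 2) (sym (dist-refl u)) z≤n

record Tour {d} (A : VSet d) : Set where
  constructor tour
  field
    origin : Vertex d
    rest   : List (Vertex d)
    linked : Linked Near (origin ∷ rest)
    inside : All (_∈ A) (origin ∷ rest)

  stops : List (Vertex d)
  stops = origin ∷ rest

open Tour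

Covers : ∀ {d} (A : VSet d) → Tour A → Set
Covers A T = ∀ y → y ∈ A → y ∈ₗ stops T

detourTour : ∀ {d} {A : VSet d} (T : Tour A) {t x} → t ∈ₗ stops T → x ∈ A → Near t x → Tour A
detourTour (tour u P l a) {t} {x} t∈ xA near =
  tour u (detour u P t∈ x) (Linked-detour u P t∈ l near (Near-sym t x near)) (All-detour u P t∈ a xA)

stutter : ∀ {d} {A : VSet d} → Tour A → Tour A
stutter (tour u P l (uA ∷ a)) = tour u (u ∷ P) (Near-refl u ∷ l) (uA ∷ uA ∷ a)

_∈?_ : ∀ {d} (y : Vertex d) (L : List (Vertex d)) → Dec (y ∈ₗ L)
y ∈? L = DecMembership._∈?_ (≡-dec _≟ᵇ_) y L

unvisited : ∀ {d} → VSet d → List (Vertex d) → ℕ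
unvisited A L = count (λ y → not (does (y ∈? L)) ∧ A y)

unvisited-< : ∀ {d} (A : VSet d) {L L′ x} → x ∈ A → ¬ x ∈ₗ L → x ∈ₗ L′ →
              (∀ {y} → y ∈ₗ L → y ∈ₗ L′) →
              unvisited A L′ < unvisited A L
unvisited-< {d} A {L} {L′} {x} xA x∉L x∈L′ L⊆L′ = sumV-mono-< d pointwise x strict
  where
  pointwise : ∀ y → χ (not (does (y ∈? L′)) ∧ A y) ≤ χ (not (does (y ∈? L)) ∧ A y)
  pointwise y with y ∈? L | y ∈? L′
  ... | yes y∈L | no y∉L′ = ⊥-elim (y∉L′ (L⊆L′ y∈L))
  ... | yes _ | yes _ = ≤-refl
  ... | no _ | yes _ = z≤n
  ... | no _ | no _ = ≤-refl
  strict : χ (not (does (x ∈? L′)) ∧ A x) < χ (not (does (x ∈? L)) ∧ A x)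
  strict rewrite dec-true (x ∈? L′) x∈L′ | dec-false (x ∈? L) x∉L | xA = s≤s z≤n

unvisited>0⇒∃ : ∀ {d} (A : VSet d) L → 0 < unvisited A L → ∃[ y ] y ∈ A × ¬ y ∈ₗ L
unvisited>0⇒∃ {d} A L pos with sumV>0⇒∃ d _ pos
... | y , χ>0 = y , ∧-conicalʳ _ (A y) marked , y∉L
  where
  marked = χ>0⇒≡true χ>0
  y∉L : ¬ y ∈ₗ L
  y∉L y∈L = case trans (sym (cong not (dec-true (y ∈? L) y∈L))) (∧-conicalˡ _ (A y) marked) of λ ()

unvisited≡0⇒covers : ∀ {d} (A : VSet d) L → unvisited A L ≡ 0 → ∀ y → y ∈ A → y ∈ₗ L
unvisited≡0⇒covers {d} A L none y yA with y ∈? L | sumV≡0⇒≡0 d _ none y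
... | yes y∈L | _ = y∈L
... | no _ | χ≡0 = case trans (sym (cong χ yA)) χ≡0 of λ ()

-- The walk from the origin to an unvisited vertex, which exists since A is 2-linked, leaves the
-- tour at some step t → x; a detour to x then visits one more vertex.
exit : ∀ {d} {A : VSet d} {L u y} → Walk2 A u y → u ∈ₗ L → ¬ y ∈ₗ L →
       ∃[ t ] ∃[ x ] t ∈ₗ L × x ∈ A × ¬ x ∈ₗ L × Near t x
exit here u∈L y∉L = ⊥-elim (y∉L u∈L)
exit {L = L} (step {w = w} wA near walk) u∈L y∉L with w ∈? L
... | yes w∈L = exit walk w∈L y∉L
... | no w∉L = _ , w , u∈L , wA , w∉L , near

extend : ∀ {d} (A : VSet d) → TwoLinked A → ∀ n (T : Tour A) → unvisited A (stops T) < n →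
         Σ[ T′ ∈ Tour A ] Covers A T′ × length (rest T′) ≤ length (rest T) + 2 * unvisited A (stops T)
extend A linkedA (suc n) T bound with unvisited A (stops T) in eq
... | zero = T , unvisited≡0⇒covers A (stops T) eq , m≤m+n _ _
... | suc m with unvisited>0⇒∃ A (stops T) (subst (0 <_) (sym eq) (s≤s z≤n))
...   | y , yA , y∉T with exit (linkedA (origin T) y (head (inside T)) yA) (here refl) y∉T
...     | t , x , t∈T , xA , x∉T , near = T″ , covers , length-T″
  where
  T′ = detourTour T t∈T xA near
  shrinks : unvisited A (stops T′) < suc m
  shrinks = subst (unvisited A (stops T′) <_) eq
    (unvisited-< A xA x∉T (∈-detour (origin T) (rest T) t∈T x) (∈-detour⁺ (origin T) (rest T) t∈T x))
  recursive = extend A linkedA n T′ (≤-trans shrinks (s≤s⁻¹ bound))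
  T″ = proj₁ recursive
  covers = proj₁ (proj₂ recursive)
  length-T″ : length (rest T″) ≤ length (rest T) + 2 * suc m
  length-T″ = begin
      length (rest T″)
    ≤⟨ proj₂ (proj₂ recursive) ⟩
      length (rest T′) + 2 * unvisited A (stops T′)
    ≡⟨ cong (_+ 2 * unvisited A (stops T′)) (length-detour (origin T) (rest T) t∈T x) ⟩
      2 + length (rest T) + 2 * unvisited A (stops T′)
    ≤⟨ +-monoʳ-≤ (2 + length (rest T)) (*-monoʳ-≤ 2 (s≤s⁻¹ shrinks)) ⟩
      2 + length (rest T) + 2 * m
    ≡⟨ regroup (length (rest T)) m ⟩
      length (rest T) + 2 * suc m ∎
    where
    open ≤-Reasoning
    regroup : ∀ ℓ m → 2 + ℓ + 2 * m ≡ ℓ + 2 * suc m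
    regroup = solve-∀

covering-tour : ∀ {d} (A : VSet d) → TwoLinked A → ∀ k → count A ≡ suc k →
                Σ[ T ∈ Tour A ] Covers A T × length (rest T) ≤ 2 * k
covering-tour A linkedA k ∣A∣≡1+k with count>0⇒∈ A (subst (0 <_) (sym ∣A∣≡1+k) (s≤s z≤n))
... | u , uA = T , covers , ≤-trans length-T (*-monoʳ-≤ 2 (s≤s⁻¹ fewer))
  where
  T₀ : Tour A
  T₀ = tour u [] [-] (uA ∷ [])
  fewer : unvisited A (stops T₀) < suc k
  fewer = subst (unvisited A (stops T₀) <_) ∣A∣≡1+k
            (unvisited-< A {L = []} {L′ = u ∷ []} uA (λ ()) (here refl) (λ ()))
  result = extend A linkedA (suc k) T₀ fewer
  T = proj₁ result
  covers = proj₁ (proj₂ result)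
  length-T = proj₂ (proj₂ result)

stutters : ∀ {d} {A : VSet d} → ℕ → Tour A → Tour A
stutters zero T = T
stutters (suc r) T = stutter (stutters r T)

length-stutters : ∀ {d} {A : VSet d} r (T : Tour A) → length (rest (stutters r T)) ≡ r + length (rest T)
length-stutters zero T = refl
length-stutters (suc r) T with stutters r T | length-stutters r T
... | tour _ _ _ (_ ∷ _) | e = cong suc e

Covers-stutters : ∀ {d} {A : VSet d} r (T : Tour A) → Covers A T → Covers A (stutters r T)
Covers-stutters zero T covers = covers
Covers-stutters (suc r) T covers y yA with stutters r T | Covers-stutters r T covers y yA
... | tour _ _ _ (_ ∷ _) | here y≡u = here y≡u
... | tour _ _ _ (_ ∷ _) | there y∈ = there (there y∈)

-- Repeating the origin pads a tour to any longer length, so all sets with the same g share one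
-- code space.
exact-covering-tour : ∀ {d} (A : VSet d) → TwoLinked A → ∀ k M → count A ≡ suc k → 2 * k ≤ M →
                      Σ[ T ∈ Tour A ] Covers A T × length (rest T) ≡ M
exact-covering-tour A linkedA k M ∣A∣≡1+k 2k≤M with covering-tour A linkedA k ∣A∣≡1+k
... | T , covers , length≤2k =
  stutters (M ∸ length (rest T)) T , Covers-stutters (M ∸ length (rest T)) T covers ,
  trans (length-stutters _ T) (m∸n+n≡m (≤-trans length≤2k 2k≤M))

-- Encoding tours

toggle : ∀ {d} → Fin (suc d) → Vertex d → Vertex d
toggle zero v = v
toggle (suc i) v = updateAt v i not

toggles : ∀ {d n} → Vec (Fin (suc d)) n → Vertex d → Vertex d
toggles [] v = v
toggles (i ∷ ts) v = toggle i (toggles ts v)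

shift : ∀ {d} → Fin (suc d) → Fin (suc (suc d))
shift zero = zero
shift (suc i) = suc (suc i)

toggles-shift : ∀ {d n} (ts : Vec (Fin (suc d)) n) x v → toggles (Vec.map shift ts) (x ∷ v) ≡ x ∷ toggles ts v
toggles-shift [] x v = refl
toggles-shift (zero ∷ ts) x v = toggles-shift ts x v
toggles-shift (suc i ∷ ts) x v = cong (toggle (suc (suc i))) (toggles-shift ts x v)

reach : ∀ {d} n (p q : Vertex d) → dist p q ≤ n → Σ[ ts ∈ Vec (Fin (suc d)) n ] q ≡ toggles ts p
reach n [] [] _ = Vec.replicate n zero , vertex₀ (toggles (Vec.replicate n zero) [])
  where
  vertex₀ : (v : Vertex 0) → [] ≡ v
  vertex₀ [] = refl
reach n (false ∷ p) (false ∷ q) h with reach n p q h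
... | ts , e = Vec.map shift ts , trans (cong (false ∷_) e) (sym (toggles-shift ts false p))
reach n (true ∷ p) (true ∷ q) h with reach n p q h
... | ts , e = Vec.map shift ts , trans (cong (true ∷_) e) (sym (toggles-shift ts true p))
reach (suc n) (false ∷ p) (true ∷ q) (s≤s h) with reach n p q h
... | ts , e = suc zero ∷ Vec.map shift ts ,
               trans (cong (true ∷_) e) (sym (cong (toggle (suc zero)) (toggles-shift ts false p)))
reach (suc n) (true ∷ p) (false ∷ q) (s≤s h) with reach n p q h
... | ts , e = suc zero ∷ Vec.map shift ts ,
               trans (cong (false ∷_) e) (sym (cong (toggle (suc zero)) (toggles-shift ts true p)))

Move : ℕ → Set
Move d = Vec (Fin (suc d)) 2

trace : ∀ {d n} → Vertex d → Vec (Move d) n → List (Vertex d)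
trace v [] = v ∷ []
trace v (s ∷ ss) = v ∷ trace (toggles s v) ss

moves : ∀ {d} {u : Vertex d} {P} → Linked Near (u ∷ P) → Σ[ ss ∈ Vec (Move d) (length P) ] trace u ss ≡ u ∷ P
moves [-] = [] , refl
moves {u = u} (near ∷ l) with reach 2 u _ near | moves l
... | s , e | ss , e′ = s ∷ ss , cong (u ∷_) (trans (cong (λ w → trace w ss) (sym e)) e′)

Code : ℕ → ℕ → Set
Code d M = Vertex d × Vec (Move d) M

decode : ∀ {d M} → Code d M → VSet d
decode (u , ss) y = does (y ∈? trace u ss)

≡does : ∀ {P : Set} {b} (P? : Dec P) → (b ≡ true → P) → (P → b ≡ true) → b ≡ does P?
≡does {b = true} P? f g = sym (dec-true P? (f refl))
≡does {b = false} P? f g = sym (dec-false P? (λ p → case g p of λ ()))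

tour-code : ∀ {d} (A : VSet d) → TwoLinked A → ∀ k M → count A ≡ suc k → 2 * k ≤ M →
            Σ[ c ∈ Code d M ] ∀ y → A y ≡ decode c y
tour-code A linkedA k M ∣A∣≡1+k 2k≤M with exact-covering-tour A linkedA k M ∣A∣≡1+k 2k≤M
... | T , covers , refl with moves (linked T)
...   | ss , trace≡stops = (origin T , ss) , λ y →
  trans (≡does (y ∈? stops T) (covers y) (lookup (inside T))) (cong (λ L → does (y ∈? L)) (sym trace≡stops))

vec↣ : ∀ {A : Set} {k} n → A ↣ Fin k → Vec A n ↣ Fin (k ^ n)
vec↣ {A} {k} n f = mk↣ (injective n)
  where
  encode : ∀ n → Vec A n → Fin (k ^ n)
  encode zero [] = zero
  encode (suc n) (x ∷ xs) = combine (Injection.to f x) (encode n xs)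
  injective : ∀ n → Injective _≡_ _≡_ (encode n)
  injective zero {[]} {[]} _ = refl
  injective (suc n) {x ∷ xs} {y ∷ ys} e with combine-injective _ _ _ _ e
  ... | e₁ , e₂ = cong₂ _∷_ (Injection.injective f e₁) (injective n e₂)

code↣ : ∀ d M → Code d M ↣ Fin (2 ^ d * (suc d ^ 2) ^ M)
code↣ d M = ↔⇒↣ (↔-sym *↔×) ↣-∘ (vec↣ d (↔⇒↣ (↔-sym 2↔Bool)) ×-↣ vec↣ M (vec↣ 2 (↣-id _)))

code-space-≤ : ∀ d l M g → suc d ≤ 2 ^ l → d + 2 * l * M ≤ g → 2 ^ d * (suc d ^ 2) ^ M ≤ 2 ^ g
code-space-≤ d l M g d<2^l fits = begin
    2 ^ d * (suc d ^ 2) ^ M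
  ≤⟨ *-monoʳ-≤ (2 ^ d) (^-monoˡ-≤ M (^-monoˡ-≤ 2 d<2^l)) ⟩
    2 ^ d * ((2 ^ l) ^ 2) ^ M
  ≡⟨ cong (2 ^ d *_) (trans (^-*-assoc (2 ^ l) 2 M) (^-*-assoc 2 l (2 * M))) ⟩
    2 ^ d * 2 ^ (l * (2 * M))
  ≡⟨ sym (^-distribˡ-+-* 2 d _) ⟩
    2 ^ (d + l * (2 * M))
  ≤⟨ ^-monoʳ-≤ 2 (subst (λ x → d + x ≤ g) (regroup l M) fits) ⟩
    2 ^ g ∎
  where
  open ≤-Reasoning
  regroup : ∀ l M → 2 * l * M ≡ l * (2 * M)
  regroup = solve-∀

AtMost-via-code : ∀ {d a g M} (code : Counted d a g → Code d M) → (∀ x v → proj₁ x v ≡ decode (code x) v) →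
                  2 ^ d * (suc d ^ 2) ^ M ≤ 2 ^ g → AtMost d a g (2 ^ g)
AtMost-via-code {d} {M = M} code decodes small = index , same-set
  where
  index = λ x → inject≤ (Injection.to (code↣ d M) (code x)) small
  same-set : ∀ x y → index x ≡ index y → ∀ v → proj₁ x v ≡ proj₁ y v
  same-set x y e v = trans (decodes x v) (trans (cong (λ c → decode c v) same-code) (sym (decodes y v)))
    where
    same-code : code x ≡ code y
    same-code = Injection.injective (code↣ d M) (inject≤-injective small small _ _ e)

-- Either k c + 2 ≤ d, and g ≥ 2d − 2 suffices, or d ≤ (k + 1) c, and then the isoperimetric bound
-- (k + 1) d ≤ 2 (k + 1 + g) L forces 2 (k + 1) c ≤ g.
bit-budget : ∀ {d k g c L} .{{_ : NonZero L}} → 1 ≤ c → 2 * L * suc (2 * c) ≤ d → d + d ≤ g + 2 →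
             suc k * d ≤ 2 * (suc k + g) * L → k * c + d ≤ g
bit-budget {d} {k} {g} {c} {L} 1≤c large-d two-vertices edges with k * c + 2 ≤? d
... | yes kc+2≤d = +-cancelʳ-≤ 2 (k * c + d) g (begin
      k * c + d + 2  ≡⟨ swap (k * c) d 2 ⟩
      k * c + 2 + d  ≤⟨ +-monoˡ-≤ d kc+2≤d ⟩
      d + d          ≤⟨ two-vertices ⟩
      g + 2          ∎)
  where
  open ≤-Reasoning
  swap : ∀ x y z → x + y + z ≡ x + z + y
  swap = solve-∀
... | no kc+2≰d = begin
      k * c + d                  ≤⟨ +-monoʳ-≤ (k * c) d≤c+kc ⟩
      k * c + (c + k * c)        ≤⟨ +-monoˡ-≤ (c + k * c) (m≤n+m (k * c) c) ⟩
      (c + k * c) + (c + k * c)  ≡⟨ double k c ⟩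
      suc k * (2 * c)            ≤⟨ many-edges ⟩
      g                          ∎
  where
  open ≤-Reasoning
  double : ∀ k c → (c + k * c) + (c + k * c) ≡ suc k * (2 * c)
  double = solve-∀
  d≤c+kc : d ≤ c + k * c
  d≤c+kc = ≤-trans (s≤s⁻¹ (subst (suc d ≤_) (+-suc (k * c) 1) (≰⇒> kc+2≰d)))
                   (≤-trans (+-monoʳ-≤ (k * c) 1≤c) (≤-reflexive (+-comm (k * c) c)))
  rearrangeˡ : ∀ k c L → k * (2 * L * suc (2 * c)) ≡ L * (2 * (k + k * (2 * c)))
  rearrangeˡ = solve-∀
  rearrangeʳ : ∀ k g L → 2 * (k + g) * L ≡ L * (2 * (k + g))
  rearrangeʳ = solve-∀
  many-edges : suc k * (2 * c) ≤ g
  many-edges = +-cancelˡ-≤ (suc k) _ _ (*-cancelˡ-≤ 2 (*-cancelˡ-≤ L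
    (subst₂ _≤_ (rearrangeˡ (suc k) c L) (rearrangeʳ (suc k) g L) (≤-trans (*-monoʳ-≤ (suc k) large-d) edges))))

-- 2 L (2c + 1) for c = 4l bits per vertex of a tour (two moves of two flips, each one of d + 1 ≤ 2^l)
-- and L = c + 1, for which |A ∪ N(A)| ≤ 2 d⁴ ≤ 2^L.
threshold : ℕ → ℕ
threshold l = 2 * suc (4 * l) * suc (2 * (4 * l))

threshold-≤ : ∀ m → 14 ≤ m → threshold (suc m) ≤ 2 ^ m
threshold-≤ m 14≤m = subst (λ m → threshold (suc m) ≤ 2 ^ m) (m∸n+n≡m 14≤m) (above-14 (m ∸ 14))
  where
  doubling : ∀ j → 2 * suc (4 * suc (suc (j + 14))) * suc (2 * (4 * suc (suc (j + 14)))) + (64 * j * j + 1816 * j + 12754)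
                   ≡ 2 * (2 * suc (4 * suc (j + 14)) * suc (2 * (4 * suc (j + 14))))
  doubling = solve-∀
  above-14 : ∀ j → threshold (suc (j + 14)) ≤ 2 ^ (j + 14)
  above-14 zero = m≤m+n 14762 1622
  above-14 (suc j) = begin
      threshold (suc (suc j + 14))
    ≤⟨ m≤m+n _ _ ⟩
      threshold (suc (suc j + 14)) + (64 * j * j + 1816 * j + 12754)
    ≡⟨ doubling j ⟩
      2 * threshold (suc (j + 14))
    ≤⟨ *-monoʳ-≤ 2 (above-14 j) ⟩
      2 ^ (suc j + 14) ∎
    where open ≤-Reasoning

n<2^n : ∀ n → n < 2 ^ n
n<2^n zero = s≤s z≤n
n<2^n (suc n) = subst (_< 2 ^ suc n) (+-comm n 1)
  (+-mono-<-≤ (n<2^n n) (≤-trans (m^n>0 2 n) (≤-reflexive (sym (+-identityʳ (2 ^ n))))))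

binary-magnitude : ∀ n d → 1 ≤ d → d < 2 ^ n → ∃[ m ] 2 ^ m ≤ d × d < 2 ^ suc m
binary-magnitude zero d 1≤d d<1 = ⊥-elim (<-irrefl refl (≤-trans 1≤d (s≤s⁻¹ d<1)))
binary-magnitude (suc n) d 1≤d d<2^1+n with d <? 2 ^ n
... | yes d<2^n = binary-magnitude n d 1≤d d<2^n
... | no d≮2^n = n , ≮⇒≥ d≮2^n , d<2^1+n

logarithmic-scale : ∀ d → 2 ^ 14 ≤ d → ∃[ m ] d < 2 ^ suc m × threshold (suc m) ≤ d
logarithmic-scale d 2^14≤d with binary-magnitude d d (≤-trans (m^n>0 2 14) 2^14≤d) (n<2^n d)
... | m , 2^m≤d , d<2^1+m = m , d<2^1+m , ≤-trans (threshold-≤ m 14≤m) 2^m≤d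
  where
  14≤m : 14 ≤ m
  14≤m = ≮⇒≥ (λ m<14 → <-irrefl refl (<-≤-trans d<2^1+m (≤-trans (^-monoʳ-≤ 2 m<14) 2^14≤d)))

bit-budget-of-set : ∀ {d g} l (A : VSet d) → 1 ≤ l → suc d ≤ 2 ^ l → threshold l ≤ d →
                    count (Nbhd A) ≡ g → g ≤ d ^ 4 → 2 ≤ count A → ∃[ k ] count A ≡ suc k × k * (4 * l) + d ≤ g
bit-budget-of-set {d} {g} l A 1≤l d<2^l threshold≤d ∣NA∣≡g g≤d⁴ 2≤∣A∣ =
  k , ∣A∣≡1+k , bit-budget {d} {k} {g} {4 * l} {L} (≤-trans (s≤s z≤n) (*-monoʳ-≤ 4 1≤l)) threshold≤d
                                   two-vertices (subst (λ K → K * d ≤ 2 * (K + g) * L) ∣A∣≡1+k edges)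
  where
  instance
    d≢0 : NonZero d
    d≢0 = >-nonZero (≤-trans (s≤s z≤n) threshold≤d)
  k = count A ∸ 1
  ∣A∣≡1+k : count A ≡ suc k
  ∣A∣≡1+k = sym (m+[n∸m]≡n (≤-trans (s≤s z≤n) 2≤∣A∣))
  L = suc (4 * l)
  S : VSet d
  S v = A v ∨ Nbhd A v
  ∣S∣≤∣A∣+g : count S ≤ count A + g
  ∣S∣≤∣A∣+g = subst (λ x → count S ≤ count A + x) ∣NA∣≡g (count-∪-≤ A (Nbhd A))
  d⁴≤2^4l : d ^ 4 ≤ 2 ^ (4 * l)
  d⁴≤2^4l = ≤-trans (^-monoˡ-≤ 4 (<⇒≤ d<2^l)) (≤-reflexive (trans (^-*-assoc 2 l 4) (cong (2 ^_) (*-comm l 4))))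
  ∣S∣≤2^L : count S ≤ 2 ^ L
  ∣S∣≤2^L = begin
      count S
    ≤⟨ ∣S∣≤∣A∣+g ⟩
      count A + g
    ≤⟨ +-monoˡ-≤ g (subst (count A ≤_) ∣NA∣≡g (count≤count-Nbhd d A)) ⟩
      g + g
    ≤⟨ +-mono-≤ (≤-trans g≤d⁴ d⁴≤2^4l) (≤-trans g≤d⁴ (≤-trans d⁴≤2^4l (≤-reflexive (sym (+-identityʳ _))))) ⟩
      2 ^ L ∎
    where open ≤-Reasoning
  edges : count A * d ≤ 2 * (count A + g) * L
  edges = ≤-trans (count*d≤inducedDegreeSum d A)
            (≤-trans (inducedDegreeSum-≤ d S L ∣S∣≤2^L) (*-monoˡ-≤ L (*-monoʳ-≤ 2 ∣S∣≤∣A∣+g)))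
  two-vertices : d + d ≤ g + 2
  two-vertices with count≥2⇒distinct A 2≤∣A∣
  ... | u , w , uA , wA , u≢w = subst (λ x → d + d ≤ x + 2) ∣NA∣≡g (two-vertices-Nbhd d A uA wA u≢w)

Regime : ℕ → ℕ → Set
Regime d g = g ≡ d ⊎ (d < g × g < d ^ 4)

Regime⇒d≤g : ∀ {d g} → Regime d g → d ≤ g
Regime⇒d≤g (inj₁ g≡d) = ≤-reflexive (sym g≡d)
Regime⇒d≤g (inj₂ (d<g , _)) = <⇒≤ d<g

bit-budget-of-counted : ∀ {d a g} l → 1 ≤ l → suc d ≤ 2 ^ l → threshold l ≤ d → Regime d g →
                        (x : Counted d a g) → ∃[ k ] count (proj₁ x) ≡ suc k × k * (4 * l) + d ≤ g
bit-budget-of-counted l _ _ _ (inj₁ g≡d) (A , _ , _ , _ , _ , isolated , _) =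
  0 , trans (sym (∣∣≡count A)) (isolated g≡d) , ≤-reflexive (sym g≡d)
bit-budget-of-counted l 1≤l d<2^l threshold≤d (inj₂ (d<g , g<d⁴)) (A , _ , _ , _ , ∣NA∣≡g , _ , small) =
  bit-budget-of-set l A 1≤l d<2^l threshold≤d (trans (sym (∣∣≡count (Nbhd A))) ∣NA∣≡g) (<⇒≤ g<d⁴)
                    (subst (2 ≤_) (∣∣≡count A) (small d<g))

counted-≤-2^g : ∀ d → 2 ^ 14 ≤ d → ∀ a g → Regime d g → AtMost d a g (2 ^ g)
counted-≤-2^g d 2^14≤d a g regime = AtMost-via-code (proj₁ ∘ code) (proj₂ ∘ code) (code-space-≤ d l M g d<2^l fits)
  where
  scaled = logarithmic-scale d 2^14≤d
  l = suc (proj₁ scaled)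
  d<2^l = proj₁ (proj₂ scaled)
  threshold≤d = proj₂ (proj₂ scaled)
  c = 4 * l
  q = (g ∸ d) / c
  M = 2 * q
  fits : d + 2 * l * M ≤ g
  fits = subst (d + 2 * l * M ≤_) (m+[n∸m]≡n (Regime⇒d≤g regime))
           (+-monoʳ-≤ d (subst (_≤ g ∸ d) (reorder q l) (m/n*n≤m (g ∸ d) c)))
    where
    reorder : ∀ q l → q * (4 * l) ≡ 2 * l * (2 * q)
    reorder = solve-∀
  code : (x : Counted d a g) → Σ[ cd ∈ Code d M ] ∀ v → proj₁ x v ≡ decode cd v
  code x@(A , _ , linkedA , _) = tour-code A linkedA k M ∣A∣≡1+k (*-monoʳ-≤ 2 k≤q)
    where
    budgeted = bit-budget-of-counted l (s≤s z≤n) d<2^l threshold≤d regime x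
    k = proj₁ budgeted
    ∣A∣≡1+k = proj₁ (proj₂ budgeted)
    k≤q : k ≤ q
    k≤q = ≤-trans (≤-reflexive (sym (m*n/n≡m k c)))
                  (/-monoˡ-≤ c (m+n≤o⇒m≤o∸n (k * c) (proj₂ (proj₂ budgeted))))

lemma4p2 : Σ ℕ λ d₀ → ∀ d → d₀ ≤ d → ∀ a g → 1 ≤ a → 1 ≤ g
    → (g ≡ d ⊎ (d < g × g < d ^ 4))
    → AtMost d a g (2 ^ g)
lemma4p2 = 2 ^ 14 , λ d 2^14≤d a g _ _ → counted-≤-2^g d 2^14≤d a g
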